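{- Let $H$ be a non-trivial graph such that some of its adjacency bases are dominating sets of $H$ and some are not. Suppose that there exists an adjacency basis $S'$ for $H$ such that $S'\not\subseteq N_H(v)$ for every $v\in V(H)\setminus S'$, and that for every adjacency basis $S$ for $H$ which is also a dominating set there exists some $v\in V(H)\setminus S$ with $S\subseteq N_H(v)$. Then for every connected graph $G$ of order $n\ge 2$, $$\operatorname{dim}_A(G\odot H)=n\cdot \operatorname{dim}_A(H)+\gamma'(G),$$ where $\gamma'(G)=\min_{v\in V(G)}\gamma(G-v)$.
   Context: All graphs are finite, simple, undirected; non-trivial means order at least 2. A set $S\subseteq V(H)$ is an adjacency generator for $H$ if for every two distinct $x,y\in V(H)\setminus S$ there exists $s\in S$ with $|N_H(s)\cap\{x,y\}|=1$ ($N_H$ the open neighbourhood); an adjacency basis is an adjacency generator of minimum cardinality, and this cardinality is $\operatorname{dim}_A(H)$. A dominating set $D$ of a graph satisfies $\bigcup_{v\in D}N[v]=V$; $\gamma$ denotes the domination number (minimum size of a dominating set). $G-v$ is the graph obtained from $G$ by deleting $v$ and its incident edges. The corona product $G\odot H$ ($G$ of order $n$ with vertices $v_1,\dots,v_n$) consists of $G$ and $n$ disjoint copies $H_1,\dots,H_n$ of $H$, with $v_i$ joined to every vertex of $H_i$. -}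

module Defs where

open import Data.Bool using (Bool; true; false; _∧_)
open import Data.Nat using (ℕ; zero; suc; _+_; _*_; _≤_)
open import Data.Fin using (Fin; splitAt; remQuot; punchIn; _≟_)
open import Data.Fin.Subset using (Subset; _∈_; _∉_; _⊆_; ∣_∣)
open import Data.Vec using (tabulate)
open import Data.Product using (Σ; ∃; _×_; _,_)
open import Data.Sum using (_⊎_; inj₁; inj₂)
open import Data.Empty using (⊥)
open import Relation.Nullary using (¬_; does)
open import Relation.Binary.PropositionalEquality using (_≡_; _≢_)

Graph : ℕ → Set
Graph n = Fin n → Fin n → Bool

IsSimple : ∀ {n} → Graph n → Set
IsSimple {n} A = (∀ (x y : Fin n) → A x y ≡ A y x) × (∀ (x : Fin n) → A x x ≡ false)

N : ∀ {n} → Graph n → Fin n → Subset n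
N A v = tabulate (λ x → A v x)

data Reach {n} (A : Graph n) : Fin n → Fin n → Set where
  here  : ∀ {x} → Reach A x x
  there : ∀ {x y z} → A x z ≡ true → Reach A z y → Reach A x y

Connected : ∀ {n} → Graph n → Set
Connected {n} A = ∀ (x y : Fin n) → Reach A x y

-- Adjacency generators / bases / adjacency dimension.
-- |N(s) ∩ {x,y}| = 1 (for x ≠ y) iff s is adjacent to exactly one of x, y.
IsAdjGen : ∀ {n} → Graph n → Subset n → Set
IsAdjGen {n} A S = ∀ (x y : Fin n) → x ≢ y → x ∉ S → y ∉ S →
  ∃ λ s → s ∈ S × (A s x ≢ A s y)

IsAdjBasis : ∀ {n} → Graph n → Subset n → Set
IsAdjBasis {n} A S = IsAdjGen A S × (∀ (T : Subset n) → IsAdjGen A T → ∣ S ∣ ≤ ∣ T ∣)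

IsAdjDim : ∀ {n} → Graph n → ℕ → Set
IsAdjDim A d = ∃ λ S → IsAdjBasis A S × ∣ S ∣ ≡ d

IsDominating : ∀ {n} → Graph n → Subset n → Set
IsDominating {n} A D = ∀ (x : Fin n) → x ∈ D ⊎ (∃ λ d → d ∈ D × A d x ≡ true)

IsDomNum : ∀ {n} → Graph n → ℕ → Set
IsDomNum {n} A g = (∃ λ D → IsDominating A D × ∣ D ∣ ≡ g)
                 × (∀ (D : Subset n) → IsDominating A D → g ≤ ∣ D ∣)

delete : ∀ {k} → Graph (suc k) → Fin (suc k) → Graph k
delete A v i j = A (punchIn v i) (punchIn v j)

IsGammaPrime : ∀ {n} → Graph n → ℕ → Set
IsGammaPrime {zero}  A g = ⊥
IsGammaPrime {suc k} A g = (∃ λ v → IsDomNum (delete A v) g)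
  × (∀ (v : Fin (suc k)) (g' : ℕ) → IsDomNum (delete A v) g' → g ≤ g')

-- Corona product G ⊙ H.  Vertex set Fin (n + n * m): the first n are the
-- vertices v_i of G, and vertex (i , a) of Fin (n * m) (via remQuot) is the
-- copy of vertex a of H in H_i.
corona : ∀ {n m} → Graph n → Graph m → Graph (n + n * m)
corona {n} {m} G H x y with splitAt n x | splitAt n y
... | inj₁ i | inj₁ j = G i j
... | inj₁ i | inj₂ q with remQuot {n} m q
...   | (l , b) = does (i ≟ l)
corona {n} {m} G H x y | inj₂ p | inj₁ j with remQuot {n} m p
...   | (k , a) = does (k ≟ j)
corona {n} {m} G H x y | inj₂ p | inj₂ q with remQuot {n} m p | remQuot {n} m q
...   | (k , a) | (l , b) = does (k ≟ l) ∧ H a b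

-- An adjacency generator T of G ⊙ H meets each copy H_i in an
-- adjacency generator T_i of H, since nothing outside H_i tells two vertices of
-- H_i apart; so |T_i| ≥ dim_A(H).  Let D be the set of i with v_i ∈ T or
-- |T_i| > dim_A(H).  For i ∉ D, T_i is a basis.  If it dominates H, the
-- hypothesis gives v ∈ H_i with T_i ⊆ N(v), and v_i, v can only be resolved by
-- some v_j ∈ T with j adjacent to i.  If it does not, an undominated vertex of
-- H_i has no neighbour in T, and two such copies outside D would leave two
-- vertices unresolved.  Hence D dominates G minus at most one vertex, so
-- γ′(G) ≤ |D| ≤ |T ∩ V(G)| + #{i : |T_i| > dim_A(H)} ≤ |T| − n·dim_A(H).
--
-- Take v₀ attaining γ′(G), a minimum dominating set D₀ of G − v₀, the basis S′
-- in H_{v₀} and a dominating basis in every other copy.  The dominating bases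
-- resolve vertices of distinct copies; v_i (i ≠ v₀) is resolved from H_i by its
-- neighbour in D₀, and v_{v₀} from x ∈ H_{v₀} by a vertex of S′ outside N(x).

module Submission where

open import Defs
open import Data.Bool using (Bool; true; false; _∧_)
open import Data.Bool.Properties using (¬-not; T-≡) renaming (_≟_ to _≟ᵇ_)
open import Data.Nat using (ℕ; zero; suc; _+_; _*_; _≤_; _<?_; _<ᵇ_; z≤n; s≤s)
open import Data.Nat.Properties
  using ( ≤-refl; ≤-trans; ≤-antisym; ≤-pred; ≮⇒≥; +-comm; +-suc; +-mono-≤; +-monoʳ-≤
        ; +-commutativeSemigroup; <ᵇ-reflects-<; <⇒<ᵇ)
open import Data.Fin using (Fin; zero; suc; splitAt; remQuot; combine; punchIn; punchOut; _≟_; _↑ˡ_; _↑ʳ_)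
import Data.Fin.Properties as Finₚ
open import Data.Fin.Subset using (Subset; inside; outside; _∈_; _∉_; _⊆_; _∪_; ∣_∣)
open import Data.Fin.Subset.Properties using (_∈?_; anySubset?; x∈p∪q⁺; ∣p∣≤∣x∷p∣)
open import Data.Vec using (Vec; []; _∷_; _++_; concat; lookup; map; sum; replicate; insertAt; removeAt; _[_]≔_)
import Data.Vec as Vec
import Data.Vec.Properties as Vecₚ
open import Data.Vec.Relation.Unary.All using (All; []; _∷_)
open import Data.Vec.Relation.Unary.All.Properties using (lookup⁻)
open import Data.Product using (∃; ∃₂; _×_; _,_; proj₁; proj₂)
open import Data.Sum using (_⊎_; inj₁; inj₂)
import Data.Sum
open import Data.Empty using (⊥; ⊥-elim)
open import Relation.Nullary using (¬_; Dec; yes; no; does)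
open import Relation.Nullary.Reflects using (ofʸ; ofⁿ)
open import Relation.Nullary.Decidable using (dec-true; dec-false; decidable-stable; ¬?; _×-dec_; _⊎-dec_; _→-dec_)
open import Relation.Unary using (Pred; Decidable)
open import Relation.Binary.PropositionalEquality
open import Function using (_∘_; Equivalence)
open import Algebra.Properties.CommutativeSemigroup +-commutativeSemigroup using (x∙yz≈y∙xz)

private
  variable
    k l : ℕ

∈⇒lookup : ∀ {x} {p : Subset k} → x ∈ p → lookup p x ≡ inside
∈⇒lookup = Vecₚ.[]=⇒lookup

lookup⇒∈ : ∀ {x} {p : Subset k} → lookup p x ≡ inside → x ∈ p
lookup⇒∈ {x = x} {p} = Vecₚ.lookup⇒[]= x p

∈-transport : ∀ {x} {y} {p : Subset k} {q : Subset l} → lookup p x ≡ lookup q y → x ∈ p → y ∈ q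
∈-transport eq x∈p = lookup⇒∈ (trans (sym eq) (∈⇒lookup x∈p))

true-false-distinct : ∀ {a b : Bool} → a ≡ true → b ≡ false → a ≢ b
true-false-distinct refl refl ()

∣p++q∣≡∣p∣+∣q∣ : (p : Subset k) (q : Subset l) → ∣ p ++ q ∣ ≡ ∣ p ∣ + ∣ q ∣
∣p++q∣≡∣p∣+∣q∣ []            q = refl
∣p++q∣≡∣p∣+∣q∣ (inside ∷ p)  q = cong suc (∣p++q∣≡∣p∣+∣q∣ p q)
∣p++q∣≡∣p∣+∣q∣ (outside ∷ p) q = ∣p++q∣≡∣p∣+∣q∣ p q

∣concat∣≡sum : (ps : Vec (Subset l) k) → ∣ concat ps ∣ ≡ sum (map ∣_∣ ps)
∣concat∣≡sum []       = refl
∣concat∣≡sum (p ∷ ps) =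
  trans (∣p++q∣≡∣p∣+∣q∣ p (concat ps)) (cong (∣ p ∣ +_) (∣concat∣≡sum ps))

∣p∪q∣≤∣p∣+∣q∣ : (p q : Subset k) → ∣ p ∪ q ∣ ≤ ∣ p ∣ + ∣ q ∣
∣p∪q∣≤∣p∣+∣q∣ []            []            = z≤n
∣p∪q∣≤∣p∣+∣q∣ (inside ∷ p)  (x ∷ q)       =
  s≤s (≤-trans (∣p∪q∣≤∣p∣+∣q∣ p q) (+-monoʳ-≤ ∣ p ∣ (∣p∣≤∣x∷p∣ x q)))
∣p∪q∣≤∣p∣+∣q∣ (outside ∷ p) (inside ∷ q)  =
  subst (suc ∣ p ∪ q ∣ ≤_) (sym (+-suc ∣ p ∣ ∣ q ∣)) (s≤s (∣p∪q∣≤∣p∣+∣q∣ p q))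
∣p∪q∣≤∣p∣+∣q∣ (outside ∷ p) (outside ∷ q) = ∣p∪q∣≤∣p∣+∣q∣ p q

∣insertAt∣ : (p : Subset k) (i : Fin (suc k)) (x : Bool) → ∣ insertAt p i x ∣ ≡ ∣ x ∷ p ∣
∣insertAt∣ p             zero    x       = refl
∣insertAt∣ (inside ∷ p)  (suc i) inside  = cong suc (∣insertAt∣ p i inside)
∣insertAt∣ (inside ∷ p)  (suc i) outside = cong suc (∣insertAt∣ p i outside)
∣insertAt∣ (outside ∷ p) (suc i) inside  = ∣insertAt∣ p i inside
∣insertAt∣ (outside ∷ p) (suc i) outside = ∣insertAt∣ p i outside

∣removeAt∣≤∣p∣ : (p : Subset (suc k)) (i : Fin (suc k)) → ∣ removeAt p i ∣ ≤ ∣ p ∣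
∣removeAt∣≤∣p∣ p i = begin
  ∣ removeAt p i ∣                               ≤⟨ ∣p∣≤∣x∷p∣ (lookup p i) (removeAt p i) ⟩
  ∣ lookup p i ∷ removeAt p i ∣                  ≡⟨ ∣insertAt∣ (removeAt p i) i (lookup p i) ⟨
  ∣ insertAt (removeAt p i) i (lookup p i) ∣     ≡⟨ cong ∣_∣ (Vecₚ.insertAt-removeAt p i) ⟩
  ∣ p ∣                                          ∎
  where open Data.Nat.Properties.≤-Reasoning

lookup-removeAt : ∀ {A : Set} (xs : Vec A (suc k)) (i : Fin (suc k)) (j : Fin k) →
  lookup (removeAt xs i) j ≡ lookup xs (punchIn i j)
lookup-removeAt xs i j = begin
  lookup (removeAt xs i) j                   ≡⟨ Vecₚ.insertAt-punchIn (removeAt xs i) i x j ⟨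
  lookup (insertAt (removeAt xs i) i x) i+j  ≡⟨ cong (λ ys → lookup ys i+j) (Vecₚ.insertAt-removeAt xs i) ⟩
  lookup xs i+j                              ∎
  where
  open ≡-Reasoning
  x = lookup xs i
  i+j = punchIn i j

sum-map-const : ∀ {A : Set} (w : A → ℕ) {d} (xs : Vec A k) → All (λ a → w a ≡ d) xs → sum (map w xs) ≡ k * d
sum-map-const w [] []         = refl
sum-map-const w (x ∷ xs) (refl ∷ all) = cong (_ +_) (sum-map-const w xs all)

sum-map-≥ : ∀ {A : Set} (w : A → ℕ) {d} (xs : Vec A k) → All (λ a → d ≤ w a) xs →
  ∣ map (λ a → d <ᵇ w a) xs ∣ + k * d ≤ sum (map w xs)
sum-map-≥ w [] []                 = z≤n
sum-map-≥ {suc k} w {d} (x ∷ xs) (d≤wx ∷ all) with d <ᵇ w x | <ᵇ-reflects-< d (w x)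
... | true  | ofʸ d<wx = subst (_≤ w x + sum (map w xs)) (cong suc (sym regroup)) (+-mono-≤ d<wx (sum-map-≥ w xs all))
  where regroup = x∙yz≈y∙xz ∣ map (λ a → d <ᵇ w a) xs ∣ d (k * d)
... | false | ofⁿ _    = subst (_≤ w x + sum (map w xs)) (sym regroup) (+-mono-≤ d≤wx (sum-map-≥ w xs all))
  where regroup = x∙yz≈y∙xz ∣ map (λ a → d <ᵇ w a) xs ∣ d (k * d)

∉oversized : ∀ {A : Set} (w : A → ℕ) {d} (xs : Vec A k) {x} →
  x ∉ map (λ a → d <ᵇ w a) xs → w (lookup xs x) ≤ d
∉oversized w {d} xs {x} x∉ =
  ≮⇒≥ (λ d<wx → x∉ (lookup⇒∈ (trans (Vecₚ.lookup-map x _ xs) (Equivalence.to T-≡ (<⇒<ᵇ d<wx)))))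

adjGen-≥ : ∀ {H : Graph k} {d T} → IsAdjDim H d → IsAdjGen H T → d ≤ ∣ T ∣
adjGen-≥ (_ , (_ , minimal) , refl) gen = minimal _ gen

adjGen-≤⇒basis : ∀ {H : Graph k} {d T} → IsAdjDim H d → IsAdjGen H T → ∣ T ∣ ≤ d → IsAdjBasis H T
adjGen-≤⇒basis dim gen ∣T∣≤d = gen , λ U genU → ≤-trans ∣T∣≤d (adjGen-≥ dim genU)

basis-size : ∀ {H : Graph k} {d T} → IsAdjDim H d → IsAdjBasis H T → ∣ T ∣ ≡ d
basis-size dim@(B , (genB , _) , refl) (genT , minimal) = ≤-antisym (minimal B genB) (adjGen-≥ dim genT)

adjGen-nonempty : ∀ {H : Graph k} {T} → 2 ≤ k → IsAdjGen H T → ∃ (_∈ T)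
adjGen-nonempty {T = T} (s≤s (s≤s _)) gen with zero ∈? T | suc zero ∈? T
... | yes 0∈T | _       = zero , 0∈T
... | no _    | yes 1∈T = suc zero , 1∈T
... | no 0∉T  | no 1∉T  = let s , s∈T , _ = gen zero (suc zero) (λ ()) 0∉T 1∉T in s , s∈T

dominated? : ∀ (A : Graph k) D x → Dec (x ∈ D ⊎ ∃ λ d → d ∈ D × A d x ≡ true)
dominated? A D x = (x ∈? D) ⊎-dec Finₚ.any? (λ d → (d ∈? D) ×-dec (A d x ≟ᵇ true))

dominating? : (A : Graph k) → Decidable (IsDominating A)
dominating? A D = Finₚ.all? (dominated? A D)

¬dominating⇒undominated : ∀ (A : Graph k) {D} → ¬ IsDominating A D →
  ∃ λ a → a ∉ D × ∀ c → c ∈ D → A c a ≡ false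
¬dominating⇒undominated {k} A {D} ¬dom
  with a , ¬dom-a ← Finₚ.¬∀⟶∃¬ k _ (dominated? A D) ¬dom
  = a , (¬dom-a ∘ inj₁) , λ c c∈D → ¬-not (λ Aca → ¬dom-a (inj₂ (c , c∈D , Aca)))

∈N⁺ : ∀ (A : Graph k) {v c} → A v c ≡ true → c ∈ N A v
∈N⁺ A {v} {c} Avc = lookup⇒∈ (trans (Vecₚ.lookup∘tabulate (A v) c) Avc)

∈N⁻ : ∀ (A : Graph k) {v c} → c ∈ N A v → A v c ≡ true
∈N⁻ A {v} {c} c∈Nv = trans (sym (Vecₚ.lookup∘tabulate (A v) c)) (∈⇒lookup c∈Nv)

⊈N⇒non-neighbour : ∀ (A : Graph k) {S v} → ¬ (S ⊆ N A v) → ∃ λ c → c ∈ S × A v c ≡ false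
⊈N⇒non-neighbour {k} A {S} {v} S⊈Nv
  with c , ¬[c∈S⇒c∈Nv] ←
    Finₚ.¬∀⟶∃¬ k (λ c → c ∈ S → c ∈ N A v) (λ c → (c ∈? S) →-dec (c ∈? N A v)) (λ ⊆ → S⊈Nv (⊆ _))
  with c ∈? S
... | yes c∈S = c , c∈S , ¬-not (λ Avc → ¬[c∈S⇒c∈Nv] (λ _ → ∈N⁺ A Avc))
... | no  c∉S = ⊥-elim (¬[c∈S⇒c∈Nv] (⊥-elim ∘ c∉S))

minimum-witness : ∀ {ℓ} {P : Pred (Subset k) ℓ} → Decidable P → ∀ {S} → P S →
  ∃ λ M → P M × ∀ T → P T → ∣ M ∣ ≤ ∣ T ∣
minimum-witness {P = P} P? {S} pS = search ∣ S ∣ S pS ≤-refl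
  where
  search : ∀ b S → P S → ∣ S ∣ ≤ b → ∃ λ M → P M × ∀ T → P T → ∣ M ∣ ≤ ∣ T ∣
  search zero    S pS ∣S∣≤0 = S , pS , λ _ _ → ≤-trans ∣S∣≤0 z≤n
  search (suc b) S pS ∣S∣≤b with anySubset? (λ T → P? T ×-dec (∣ T ∣ <? ∣ S ∣))
  ... | yes (T , pT , ∣T∣<∣S∣) = search b T pT (≤-pred (≤-trans ∣T∣<∣S∣ ∣S∣≤b))
  ... | no  ¬smaller          = S , pS , λ T pT → ≮⇒≥ (λ ∣T∣<∣S∣ → ¬smaller (T , pT , ∣T∣<∣S∣))

DominatesExcept : Graph k → Fin k → Subset k → Set
DominatesExcept A u D = ∀ x → x ≢ u → x ∈ D ⊎ ∃ λ j → j ≢ u × j ∈ D × A j x ≡ true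

dominatesExcept⇒dominating-delete : ∀ (G : Graph (suc k)) {u D} →
  DominatesExcept G u D → IsDominating (delete G u) (removeAt D u)
dominatesExcept⇒dominating-delete G {u} {D} dom w with dom (punchIn u w) (Finₚ.punchInᵢ≢i u w)
... | inj₁ x∈D = inj₁ (∈-transport (sym (lookup-removeAt D u w)) x∈D)
... | inj₂ (j , j≢u , j∈D , Gjx) =
  inj₂ (punchOut u≢j , ∈-transport (sym (trans (lookup-removeAt D u _) (cong (lookup D) j-back))) j∈D ,
        trans (cong (λ z → G z (punchIn u w)) j-back) Gjx)
  where
  u≢j = j≢u ∘ sym
  j-back = Finₚ.punchIn-punchOut u≢j

γ′≤-delete : ∀ {G : Graph (suc k)} {g} → IsGammaPrime G g →
  ∀ v {R} → IsDominating (delete G v) R → g ≤ ∣ R ∣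
γ′≤-delete {G = G} (_ , least) v domR
  with M , domM , minimal ← minimum-witness (dominating? (delete G v)) domR
  = ≤-trans (least v ∣ M ∣ ((M , domM , refl) , minimal)) (minimal _ domR)

γ′≤-except : ∀ {G : Graph (suc k)} {g u D} → IsGammaPrime G g → DominatesExcept G u D → g ≤ ∣ D ∣
γ′≤-except {G = G} {u = u} {D} γ′ dom =
  ≤-trans (γ′≤-delete {G = G} γ′ u (dominatesExcept⇒dominating-delete G dom)) (∣removeAt∣≤∣p∣ D u)

γ′≤-dominating : ∀ {G : Graph (suc k)} {g D} → IsGammaPrime G g → IsDominating G D → g ≤ ∣ D ∣
γ′≤-dominating {G = G} {D = D} γ′ dom with Finₚ.any? (λ u → ¬? (u ∈? D))
... | yes (u , u∉D) = γ′≤-except {G = G} γ′ λ x _ →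
  Data.Sum.map₂ (λ (j , j∈D , Gjx) → j , (λ { refl → u∉D j∈D }) , j∈D , Gjx) (dom x)
... | no  ∄u∉D = γ′≤-except {G = G} {u = zero} γ′ λ x _ →
  inj₁ (decidable-stable (x ∈? D) (λ x∉D → ∄u∉D (x , x∉D)))

module Corona {n m} (G : Graph n) (H : Graph m) where

  V : Set
  V = Fin (n + n * m)

  gv : Fin n → V
  gv i = i ↑ˡ n * m

  cv : Fin n → Fin m → V
  cv i a = n ↑ʳ combine i a

  data View : V → Set where
    isG : ∀ i → View (gv i)
    isC : ∀ i a → View (cv i a)

  view : ∀ x → View x
  view x with splitAt n x in eq
  ... | inj₁ i = subst View (Finₚ.splitAt⁻¹-↑ˡ eq) (isG i)
  ... | inj₂ q = subst View (trans (cong (n ↑ʳ_) (Finₚ.combine-remQuot {n} m q)) (Finₚ.splitAt⁻¹-↑ʳ eq)) (isC _ _)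

  cv-injective : ∀ i a j b → cv i a ≡ cv j b → i ≡ j × a ≡ b
  cv-injective i a j b = Finₚ.combine-injective i a j b ∘ Finₚ.↑ʳ-injective n _ _

  gv≢cv : ∀ i j b → gv i ≢ cv j b
  gv≢cv i j b eq with
    trans (sym (Finₚ.splitAt-↑ˡ n i (n * m))) (trans (cong (splitAt n) eq) (Finₚ.splitAt-↑ʳ n (n * m) (combine j b)))
  ... | ()

  module Membership (p : Subset n) (ps : Vec (Subset m) n) where

    lookup-gv : ∀ i → lookup (p ++ concat ps) (gv i) ≡ lookup p i
    lookup-gv i = Vecₚ.lookup-++ˡ p (concat ps) i

    lookup-cv : ∀ i a → lookup (p ++ concat ps) (cv i a) ≡ lookup (lookup ps i) a
    lookup-cv i a = trans (Vecₚ.lookup-++ʳ p (concat ps) (combine i a)) (Vecₚ.lookup-concat ps i a)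

    gv∈⁺ : ∀ {i} → i ∈ p → gv i ∈ p ++ concat ps
    gv∈⁺ {i} = ∈-transport (sym (lookup-gv i))

    gv∈⁻ : ∀ {i} → gv i ∈ p ++ concat ps → i ∈ p
    gv∈⁻ {i} = ∈-transport (lookup-gv i)

    cv∈⁺ : ∀ {i a} → a ∈ lookup ps i → cv i a ∈ p ++ concat ps
    cv∈⁺ {i} {a} = ∈-transport (sym (lookup-cv i a))

    cv∈⁻ : ∀ {i a} → cv i a ∈ p ++ concat ps → a ∈ lookup ps i
    cv∈⁻ {i} {a} = ∈-transport (lookup-cv i a)

  decomposition : ∀ (T : Subset (n + n * m)) → ∃₂ λ p ps → T ≡ p ++ concat ps
  decomposition T with p , rest , refl ← Vec.splitAt n T with ps , refl ← Vec.group n m rest = p , ps , refl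

  cor : Graph (n + n * m)
  cor = corona G H

  gv-gv : ∀ i j → cor (gv i) (gv j) ≡ G i j
  gv-gv i j rewrite Finₚ.splitAt-↑ˡ n i (n * m) | Finₚ.splitAt-↑ˡ n j (n * m) = refl

  gv-cv : ∀ i j b → cor (gv i) (cv j b) ≡ does (i ≟ j)
  gv-cv i j b rewrite Finₚ.splitAt-↑ˡ n i (n * m) | Finₚ.splitAt-↑ʳ n (n * m) (combine j b) =
    cong (λ p → does (i ≟ proj₁ p)) (Finₚ.remQuot-combine {n} {m} j b)

  cv-gv : ∀ i a j → cor (cv i a) (gv j) ≡ does (i ≟ j)
  cv-gv i a j rewrite Finₚ.splitAt-↑ʳ n (n * m) (combine i a) | Finₚ.splitAt-↑ˡ n j (n * m) =
    cong (λ p → does (proj₁ p ≟ j)) (Finₚ.remQuot-combine {n} {m} i a)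

  cv-cv : ∀ i a j b → cor (cv i a) (cv j b) ≡ does (i ≟ j) ∧ H a b
  cv-cv i a j b rewrite Finₚ.splitAt-↑ʳ n (n * m) (combine i a) | Finₚ.splitAt-↑ʳ n (n * m) (combine j b) =
    cong₂ (λ p q → does (proj₁ p ≟ proj₁ q) ∧ H (proj₂ p) (proj₂ q))
      (Finₚ.remQuot-combine {n} {m} i a) (Finₚ.remQuot-combine {n} {m} j b)

  gv-cv-other : ∀ i j b → i ≢ j → cor (gv i) (cv j b) ≡ false
  gv-cv-other i j b i≢j = trans (gv-cv i j b) (dec-false (i ≟ j) i≢j)

  cv-gv-own : ∀ i a → cor (cv i a) (gv i) ≡ true
  cv-gv-own i a = trans (cv-gv i a i) (dec-true (i ≟ i) refl)

  cv-gv-other : ∀ i a j → i ≢ j → cor (cv i a) (gv j) ≡ false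
  cv-gv-other i a j i≢j = trans (cv-gv i a j) (dec-false (i ≟ j) i≢j)

  cv-cv-own : ∀ i a b → cor (cv i a) (cv i b) ≡ H a b
  cv-cv-own i a b = trans (cv-cv i a i b) (cong (_∧ H a b) (dec-true (i ≟ i) refl))

  cv-cv-other : ∀ i a j b → i ≢ j → cor (cv i a) (cv j b) ≡ false
  cv-cv-other i a j b i≢j = trans (cv-cv i a j b) (cong (_∧ H a b) (dec-false (i ≟ j) i≢j))

module LowerBound
  {k m d g} {G : Graph (suc k)} {H : Graph m}
  (H-symmetric : ∀ a b → H a b ≡ H b a)
  (dim : IsAdjDim H d)
  (dominating-basis-covered : ∀ S → IsAdjBasis H S → IsDominating H S → ∃ λ v → v ∉ S × S ⊆ N H v)
  (γ′ : IsGammaPrime G g)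
  (TG : Subset (suc k)) (Ts : Vec (Subset m) (suc k))
  (gen : IsAdjGen (corona G H) (TG ++ concat Ts))
  where

  open Corona G H
  open Membership TG Ts

  T : Subset (suc k + suc k * m)
  T = TG ++ concat Ts

  copy-gen : ∀ i → IsAdjGen H (lookup Ts i)
  copy-gen i a b a≢b a∉ b∉
    with s , s∈T , s-resolves ←
      gen (cv i a) (cv i b) (a≢b ∘ proj₂ ∘ cv-injective i a i b) (a∉ ∘ cv∈⁻) (b∉ ∘ cv∈⁻)
    = resolve (view s) s∈T s-resolves
    where
    resolve : ∀ {s} → View s → s ∈ T → cor s (cv i a) ≢ cor s (cv i b) →
      ∃ λ c → c ∈ lookup Ts i × H c a ≢ H c b
    resolve (isG j) _ ne = ⊥-elim (ne (trans (gv-cv j i a) (sym (gv-cv j i b))))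
    resolve (isC j c) c∈T ne with j ≟ i
    ... | yes refl = c , cv∈⁻ c∈T , λ e → ne (trans (cv-cv-own j c a) (trans e (sym (cv-cv-own j c b))))
    ... | no  j≢i  = ⊥-elim (ne (trans (cv-cv-other j c i a j≢i) (sym (cv-cv-other j c i b j≢i))))

  Oversized : Subset (suc k)
  Oversized = map (λ S → d <ᵇ ∣ S ∣) Ts

  D : Subset (suc k)
  D = TG ∪ Oversized

  ∉D⇒∉TG : ∀ {x} → x ∉ D → x ∉ TG
  ∉D⇒∉TG x∉D = x∉D ∘ x∈p∪q⁺ ∘ inj₁

  ∉D⇒basis : ∀ {x} → x ∉ D → IsAdjBasis H (lookup Ts x)
  ∉D⇒basis x∉D = adjGen-≤⇒basis dim (copy-gen _) (∉oversized ∣_∣ Ts (x∉D ∘ x∈p∪q⁺ ∘ inj₂))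

  dominated-from-TG : ∀ {x} → x ∉ D → IsDominating H (lookup Ts x) → ∃ λ j → j ∈ TG × G j x ≡ true
  dominated-from-TG {x} x∉D dom
    with v , v∉ , ⊆Nv ← dominating-basis-covered (lookup Ts x) (∉D⇒basis x∉D) dom
    with s , s∈T , s-resolves ← gen (gv x) (cv x v) (gv≢cv x x v) (∉D⇒∉TG x∉D ∘ gv∈⁻) (v∉ ∘ cv∈⁻)
    = resolve (view s) s∈T s-resolves
    where
    resolve : ∀ {s} → View s → s ∈ T → cor s (gv x) ≢ cor s (cv x v) → ∃ λ j → j ∈ TG × G j x ≡ true
    resolve (isG j) j∈T ne with j ≟ x
    ... | yes refl = ⊥-elim (∉D⇒∉TG x∉D (gv∈⁻ j∈T))
    ... | no  j≢x  = j , gv∈⁻ j∈T , ¬-not (λ Gjx → ne (trans (gv-gv j x) (trans Gjx (sym (gv-cv-other j x v j≢x)))))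
    resolve (isC j c) c∈T ne with j ≟ x
    ... | yes refl = ⊥-elim (ne (trans (cv-gv-own j c)
                       (sym (trans (cv-cv-own j c v) (trans (H-symmetric c v) (∈N⁻ H (⊆Nv (cv∈⁻ c∈T))))))))
    ... | no  j≢x  = ⊥-elim (ne (trans (cv-gv-other j c x j≢x) (sym (cv-cv-other j c x v j≢x))))

  dominated-from-D : ∀ {x} → x ∉ D → IsDominating H (lookup Ts x) → ∃ λ j → j ∈ D × G j x ≡ true
  dominated-from-D x∉D dom with j , j∈TG , Gjx ← dominated-from-TG x∉D dom = j , x∈p∪q⁺ (inj₁ j∈TG) , Gjx

  -- Undominated a ∈ H_x and b ∈ H_u have the same neighbours in T.
  undominated-copy-unique : ∀ {x u} → x ≢ u → x ∉ D → u ∉ D →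
    ¬ IsDominating H (lookup Ts x) → ¬ IsDominating H (lookup Ts u) → ⊥
  undominated-copy-unique {x} {u} x≢u x∉D u∉D ¬dom-x ¬dom-u
    with a , a∉ , a-undominated ← ¬dominating⇒undominated H ¬dom-x
    with b , b∉ , b-undominated ← ¬dominating⇒undominated H ¬dom-u
    with s , s∈T , s-resolves ←
      gen (cv x a) (cv u b) (x≢u ∘ proj₁ ∘ cv-injective x a u b) (a∉ ∘ cv∈⁻) (b∉ ∘ cv∈⁻)
    = resolve (view s) s∈T s-resolves
    where
    resolve : ∀ {s} → View s → s ∈ T → cor s (cv x a) ≢ cor s (cv u b) → ⊥
    resolve (isG j) j∈T ne with j ≟ x | j ≟ u
    ... | yes refl | _        = ∉D⇒∉TG x∉D (gv∈⁻ j∈T)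
    ... | no  _    | yes refl = ∉D⇒∉TG u∉D (gv∈⁻ j∈T)
    ... | no  j≢x  | no  j≢u  = ne (trans (gv-cv-other j x a j≢x) (sym (gv-cv-other j u b j≢u)))
    resolve (isC j c) c∈T ne with j ≟ x | j ≟ u
    ... | yes refl | _        =
      ne (trans (cv-cv-own j c a) (trans (a-undominated c (cv∈⁻ c∈T)) (sym (cv-cv-other j c u b x≢u))))
    ... | no  j≢x  | yes refl =
      ne (trans (cv-cv-other j c x a j≢x) (sym (trans (cv-cv-own j c b) (b-undominated c (cv∈⁻ c∈T)))))
    ... | no  j≢x  | no  j≢u  = ne (trans (cv-cv-other j c x a j≢x) (sym (cv-cv-other j c u b j≢u)))

  γ′≤∣D∣ : g ≤ ∣ D ∣
  γ′≤∣D∣ with Finₚ.any? (λ u → ¬? (u ∈? D) ×-dec ¬? (dominating? H (lookup Ts u)))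
  ... | yes (u , u∉D , ¬dom-u) = γ′≤-except {G = G} γ′ dominates-except-u
    where
    dominates-except-u : DominatesExcept G u D
    dominates-except-u x x≢u with x ∈? D
    ... | yes x∈D = inj₁ x∈D
    ... | no  x∉D with dominating? H (lookup Ts x)
    ...   | no  ¬dom-x = ⊥-elim (undominated-copy-unique x≢u x∉D u∉D ¬dom-x ¬dom-u)
    ...   | yes dom-x with j , j∈D , Gjx ← dominated-from-D x∉D dom-x
            = inj₂ (j , (λ { refl → u∉D j∈D }) , j∈D , Gjx)
  ... | no  ∄bad = γ′≤-dominating {G = G} γ′ dominates
    where
    dominates : IsDominating G D
    dominates x with x ∈? D
    ... | yes x∈D = inj₁ x∈D
    ... | no  x∉D with dominating? H (lookup Ts x)
    ...   | yes dom-x = inj₂ (dominated-from-D x∉D dom-x)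
    ...   | no  ¬dom-x = ⊥-elim (∄bad (x , x∉D , ¬dom-x))

  ∣T∣≡∣TG∣+sum : ∣ T ∣ ≡ ∣ TG ∣ + sum (map ∣_∣ Ts)
  ∣T∣≡∣TG∣+sum = trans (∣p++q∣≡∣p∣+∣q∣ TG (concat Ts)) (cong (∣ TG ∣ +_) (∣concat∣≡sum Ts))

  lower-bound : suc k * d + g ≤ ∣ T ∣
  lower-bound = begin
    nd + g                      ≤⟨ +-monoʳ-≤ nd (≤-trans γ′≤∣D∣ (∣p∪q∣≤∣p∣+∣q∣ TG Oversized)) ⟩
    nd + (∣ TG ∣ + ∣ Oversized ∣) ≡⟨ x∙yz≈y∙xz nd ∣ TG ∣ ∣ Oversized ∣ ⟩
    ∣ TG ∣ + (nd + ∣ Oversized ∣) ≡⟨ cong (∣ TG ∣ +_) (+-comm nd ∣ Oversized ∣) ⟩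
    ∣ TG ∣ + (∣ Oversized ∣ + nd) ≤⟨ +-monoʳ-≤ ∣ TG ∣ (sum-map-≥ ∣_∣ Ts copies-≥d) ⟩
    ∣ TG ∣ + sum (map ∣_∣ Ts)     ≡⟨ ∣T∣≡∣TG∣+sum ⟨
    ∣ T ∣                         ∎
    where
    open Data.Nat.Properties.≤-Reasoning
    nd = suc k * d
    copies-≥d = lookup⁻ (adjGen-≥ dim ∘ copy-gen)

module UpperBound
  {k m d} {G : Graph (suc k)} {H : Graph m}
  (H-symmetric : ∀ a b → H a b ≡ H b a)
  (G-irreflexive : ∀ x → G x x ≡ false)
  (m≥2 : 2 ≤ m)
  (dim : IsAdjDim H d)
  {S} (S-basis : IsAdjBasis H S) (S-dominating : IsDominating H S)
  {S′} (S′-basis : IsAdjBasis H S′) (S′-uncovered : ∀ v → v ∉ S′ → ¬ (S′ ⊆ N H v))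
  (v₀ : Fin (suc k)) {D₀ : Subset k} (D₀-dominating : IsDominating (delete G v₀) D₀)
  where

  open Corona G H

  DG : Subset (suc k)
  DG = insertAt D₀ v₀ outside

  Ss : Vec (Subset m) (suc k)
  Ss = replicate (suc k) S [ v₀ ]≔ S′

  R : Subset (suc k + suc k * m)
  R = DG ++ concat Ss

  open Membership DG Ss

  punchIn∈DG : ∀ {j} → j ∈ D₀ → punchIn v₀ j ∈ DG
  punchIn∈DG {j} = ∈-transport (sym (Vecₚ.insertAt-punchIn D₀ v₀ outside j))

  Ss-v₀ : lookup Ss v₀ ≡ S′
  Ss-v₀ = Vecₚ.lookup∘update v₀ (replicate (suc k) S) S′

  Ss-other : ∀ {i} → i ≢ v₀ → lookup Ss i ≡ S
  Ss-other {i} i≢v₀ = trans (Vecₚ.lookup∘update′ i≢v₀ (replicate (suc k) S) S′) (Vecₚ.lookup-replicate i S)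

  Ss-basis : ∀ i → IsAdjBasis H (lookup Ss i)
  Ss-basis i with i ≟ v₀
  ... | yes refl = subst (IsAdjBasis H) (sym Ss-v₀) S′-basis
  ... | no  i≢v₀ = subst (IsAdjBasis H) (sym (Ss-other i≢v₀)) S-basis

  ∣R∣ : ∣ R ∣ ≡ suc k * d + ∣ D₀ ∣
  ∣R∣ = begin
    ∣ DG ++ concat Ss ∣           ≡⟨ ∣p++q∣≡∣p∣+∣q∣ DG (concat Ss) ⟩
    ∣ DG ∣ + ∣ concat Ss ∣        ≡⟨ cong₂ _+_ (∣insertAt∣ D₀ v₀ outside) (∣concat∣≡sum Ss) ⟩
    ∣ D₀ ∣ + sum (map ∣_∣ Ss)     ≡⟨ cong (∣ D₀ ∣ +_) (sum-map-const ∣_∣ Ss copies-≡d) ⟩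
    ∣ D₀ ∣ + suc k * d            ≡⟨ +-comm ∣ D₀ ∣ (suc k * d) ⟩
    suc k * d + ∣ D₀ ∣            ∎
    where
    open ≡-Reasoning
    copies-≡d = lookup⁻ (basis-size dim ∘ Ss-basis)

  Resolved : V → V → Set
  Resolved x y = ∃ λ s → s ∈ R × cor s x ≢ cor s y

  resolved-sym : ∀ {x y} → Resolved x y → Resolved y x
  resolved-sym (s , s∈R , ne) = s , s∈R , ne ∘ sym

  own-copy-vertex : ∀ i → ∃ λ c → cv i c ∈ R
  own-copy-vertex i with c , c∈ ← adjGen-nonempty m≥2 (proj₁ (Ss-basis i)) = c , cv∈⁺ c∈

  gv-gv-resolved : ∀ i j → i ≢ j → Resolved (gv i) (gv j)
  gv-gv-resolved i j i≢j with c , c∈R ← own-copy-vertex i =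
    cv i c , c∈R , true-false-distinct (cv-gv-own i c) (cv-gv-other i c j i≢j)

  other-copy-resolved : ∀ i j b → i ≢ j → Resolved (gv i) (cv j b)
  other-copy-resolved i j b i≢j with c , c∈R ← own-copy-vertex i =
    cv i c , c∈R , true-false-distinct (cv-gv-own i c) (cv-cv-other i c j b i≢j)

  v₀-resolved : ∀ a → a ∉ S′ → Resolved (gv v₀) (cv v₀ a)
  v₀-resolved a a∉S′ with c , c∈S′ , Hac ← ⊈N⇒non-neighbour H (S′-uncovered a a∉S′) =
    cv v₀ c , cv∈⁺ (subst (c ∈_) (sym Ss-v₀) c∈S′) ,
    true-false-distinct (cv-gv-own v₀ c) (trans (cv-cv-own v₀ c a) (trans (H-symmetric c a) Hac))

  -- A neighbour v_j of v_i with j ∈ D₀ is adjacent to v_i but to no vertex of H_i.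
  dominated-resolved : ∀ w a → w ∉ D₀ → Resolved (gv (punchIn v₀ w)) (cv (punchIn v₀ w) a)
  dominated-resolved w a w∉D₀ with D₀-dominating w
  ... | inj₁ w∈D₀ = ⊥-elim (w∉D₀ w∈D₀)
  ... | inj₂ (j , j∈D₀ , Gjw) =
    gv (punchIn v₀ j) , gv∈⁺ (punchIn∈DG j∈D₀) ,
    true-false-distinct (trans (gv-gv _ _) Gjw) (gv-cv-other (punchIn v₀ j) (punchIn v₀ w) a
                      λ eq → true-false-distinct Gjw (G-irreflexive _) (cong (λ z → G z (punchIn v₀ w)) eq))

  gv-cv-resolved : ∀ i j a → i ∉ DG → a ∉ lookup Ss j → Resolved (gv i) (cv j a)
  gv-cv-resolved i j a i∉DG a∉ with i ≟ j
  ... | no  i≢j  = other-copy-resolved i j a i≢j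
  ... | yes refl with i ≟ v₀
  ...   | yes refl = v₀-resolved a (subst (a ∉_) Ss-v₀ a∉)
  ...   | no  i≢v₀ = subst (λ z → Resolved (gv z) (cv z a)) back
                        (dominated-resolved w a (λ w∈D₀ → i∉DG (subst (_∈ DG) back (punchIn∈DG w∈D₀))))
    where
    w = punchOut (i≢v₀ ∘ sym)
    back = Finₚ.punchIn-punchOut (i≢v₀ ∘ sym)

  dominating-copy-resolved : ∀ i a j b → i ≢ v₀ → i ≢ j → a ∉ lookup Ss i → Resolved (cv i a) (cv j b)
  dominating-copy-resolved i a j b i≢v₀ i≢j a∉ with S-dominating a
  ... | inj₁ a∈S = ⊥-elim (a∉ (subst (a ∈_) (sym (Ss-other i≢v₀)) a∈S))
  ... | inj₂ (c , c∈S , Hca) =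
    cv i c , cv∈⁺ (subst (c ∈_) (sym (Ss-other i≢v₀)) c∈S) ,
    true-false-distinct (trans (cv-cv-own i c a) Hca) (cv-cv-other i c j b i≢j)

  cv-cv-resolved : ∀ i a j b → cv i a ≢ cv j b → a ∉ lookup Ss i → b ∉ lookup Ss j →
    Resolved (cv i a) (cv j b)
  cv-cv-resolved i a j b ne a∉ b∉ with i ≟ j
  ... | yes refl with c , c∈ , Hca≢Hcb ← proj₁ (Ss-basis i) a b (ne ∘ cong (cv i)) a∉ b∉ =
    cv i c , cv∈⁺ c∈ , λ e → Hca≢Hcb (trans (sym (cv-cv-own i c a)) (trans e (cv-cv-own i c b)))
  ... | no i≢j with i ≟ v₀
  ...   | no  i≢v₀ = dominating-copy-resolved i a j b i≢v₀ i≢j a∉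
  ...   | yes refl = resolved-sym {cv j b} (dominating-copy-resolved j b i a (i≢j ∘ sym) (i≢j ∘ sym) b∉)

  generator : IsAdjGen cor R
  generator x y x≢y x∉R y∉R = resolve (view x) (view y) x≢y x∉R y∉R
    where
    resolve : ∀ {x y} → View x → View y → x ≢ y → x ∉ R → y ∉ R → Resolved x y
    resolve (isG i)   (isG j)   ne i∉ j∉ = gv-gv-resolved i j (ne ∘ cong gv)
    resolve (isG i)   (isC j b) ne i∉ b∉ = gv-cv-resolved i j b (i∉ ∘ gv∈⁺) (b∉ ∘ cv∈⁺)
    resolve (isC i a) (isG j)   ne a∉ j∉ = resolved-sym {gv j} (gv-cv-resolved j i a (j∉ ∘ gv∈⁺) (a∉ ∘ cv∈⁺))
    resolve (isC i a) (isC j b) ne a∉ b∉ = cv-cv-resolved i a j b ne (a∉ ∘ cv∈⁺) (b∉ ∘ cv∈⁺)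

theorem12 : (m : ℕ) (H : Graph m) → IsSimple H → 2 ≤ m →
    (∃ λ S → IsAdjBasis H S × IsDominating H S) →
    (∃ λ S → IsAdjBasis H S × ¬ IsDominating H S) →
    (∃ λ S′ → IsAdjBasis H S′ × (∀ (v : Fin m) → v ∉ S′ → ¬ (S′ ⊆ N H v))) →
    (∀ (S : Subset m) → IsAdjBasis H S → IsDominating H S →
      ∃ λ v → v ∉ S × S ⊆ N H v) →
    (n : ℕ) (G : Graph n) → IsSimple G → Connected G → 2 ≤ n →
    (d g : ℕ) → IsAdjDim H d → IsGammaPrime G g →
    IsAdjDim (corona G H) (n * d + g)
theorem12 m H (H-symmetric , _) m≥2 (S , S-basis , S-dominating) _ (S′ , S′-basis , S′-uncovered) covered
          (suc k) G (_ , G-irreflexive) _ _ d g dim γ′@((v₀ , (D₀ , D₀-dominating , ∣D₀∣≡g) , _) , _) =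
  R , (generator , minimal) , size
  where
  open UpperBound {G = G} H-symmetric G-irreflexive m≥2 dim
         S-basis S-dominating S′-basis S′-uncovered v₀ D₀-dominating

  size : ∣ R ∣ ≡ suc k * d + g
  size = trans ∣R∣ (cong (suc k * d +_) ∣D₀∣≡g)

  minimal : ∀ T → IsAdjGen (corona G H) T → ∣ R ∣ ≤ ∣ T ∣
  minimal T gen with TG , Ts , refl ← Corona.decomposition G H T =
    subst (_≤ ∣ T ∣) (sym size) (LowerBound.lower-bound {G = G} H-symmetric dim covered γ′ TG Ts gen)
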